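{- Let $k$ be a positive integer and $G$ a graph. (1) If $(A,B)$ is a separation of $G$ of $\theta$-order $k$, then $(\widetilde{A},\widetilde{B})$ is a separation of $\widetilde{G}$ of order at most $k\cdot\widetilde{\omega}(G)$. (2) If $(\widetilde{A},\widetilde{B})$ is a separation of $\widetilde{G}$ of order $k$, then $(\bigcup\widetilde{A},\bigcup\widetilde{B})$ is a separation of $G$ of $\theta$-order at most $k$.
   Context: All graphs finite and simple. Two vertices are equivalent if they lie in exactly the same maximal cliques (true twins); $\widetilde{v}$ is the class of $v$; the clique-quotient graph $\widetilde{G}$ has the classes as vertices, two distinct classes adjacent iff their vertices are adjacent in $G$. For $X\subseteq V(G)$, $\widetilde{X}=\{\widetilde{x}:x\in X\}$; for a set $\widetilde{X}$ of vertices of $\widetilde{G}$, $\bigcup\widetilde{X}$ is the set of vertices of $G$ whose class lies in $\widetilde{X}$. A separation of a graph $H$ is a pair $(A,B)$ of vertex sets with no edge between $A\setminus B$ and $B\setminus A$; its order is $|A\cap B|$ and its $\theta$-order is $\theta(H[A\cap B])$, where $\theta$ is the clique-cover number. $\widetilde{\omega}(G)$ is the maximum, over maximal cliques $K$ of $G$, of the number of classes intersecting $K$. -}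

module Defs where

open import Data.Nat using (ℕ; _≤_; _*_)
open import Data.Bool using (Bool; true; false)
open import Data.Fin using (Fin; _≟_)
open import Data.Fin.Properties using (any?)
open import Data.Fin.Subset using (Subset; _∈_; _∉_; _⊆_; _∩_; ∣_∣)
open import Data.Fin.Subset.Properties using (_∈?_)
open import Data.Vec using (tabulate; lookup)
open import Data.Product using (Σ; ∃; _×_; _,_)
open import Relation.Nullary using (¬_; does)
open import Relation.Nullary.Decidable using (_×-dec_)
open import Relation.Binary.PropositionalEquality using (_≡_; _≢_)
open import Function.Bundles using (_⇔_)

record SimpleGraph (n : ℕ) : Set where
  field
    adj    : Fin n → Fin n → Bool
    sym    : ∀ u v → adj u v ≡ adj v u
    irrefl : ∀ v → adj v v ≡ false
open SimpleGraph public

module _ {n : ℕ} (G : SimpleGraph n) where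

  IsClique : Subset n → Set
  IsClique K = ∀ u v → u ∈ K → v ∈ K → u ≢ v → adj G u v ≡ true

  IsMaximalClique : Subset n → Set
  IsMaximalClique K = IsClique K × (∀ K′ → IsClique K′ → K ⊆ K′ → K′ ⊆ K)

  Twins : Fin n → Fin n → Set
  Twins u v = ∀ K → IsMaximalClique K → (u ∈ K ⇔ v ∈ K)

  -- S is covered by t cliques of G[S] (cliques may be empty)
  CliqueCover : Subset n → ℕ → Set
  CliqueCover S t =
    Σ (Fin t → Subset n) λ K →
      (∀ i → IsClique (K i) × K i ⊆ S) × (∀ v → v ∈ S → ∃ λ i → v ∈ K i)

  CliqueCoverNumber : Subset n → ℕ → Set
  CliqueCoverNumber S k = CliqueCover S k × (∀ t → CliqueCover S t → k ≤ t)

  CliqueCoverNumber≤ : Subset n → ℕ → Set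
  CliqueCoverNumber≤ S k = Σ ℕ λ t → t ≤ k × CliqueCover S t

IsSeparation : {n : ℕ} → (Fin n → Fin n → Set) → Subset n → Subset n → Set
IsSeparation E A B =
  ∀ u v → u ∈ A → u ∉ B → v ∈ B → v ∉ A → ¬ E u v

-- The clique-quotient of G, presented by a surjective class map
-- cls : V(G) → Fin m whose fibres are exactly the twin classes.
record TwinQuotient {n : ℕ} (G : SimpleGraph n) : Set where
  field
    m       : ℕ
    cls     : Fin n → Fin m
    cls-surj : ∀ c → ∃ λ v → cls v ≡ c
    cls-twin : ∀ u v → (cls u ≡ cls v) ⇔ Twins G u v
open TwinQuotient public

module _ {n : ℕ} {G : SimpleGraph n} (Q : TwinQuotient G) where

  QAdj : Fin (m Q) → Fin (m Q) → Set
  QAdj c d = c ≢ d × ∃ λ u → ∃ λ v → cls Q u ≡ c × cls Q v ≡ d × adj G u v ≡ true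

  tildeSet : Subset n → Subset (m Q)
  tildeSet X = tabulate λ c → does (any? (λ v → (v ∈? X) ×-dec (cls Q v ≟ c)))

  unionSet : Subset (m Q) → Subset n
  unionSet Y = tabulate λ v → lookup Y (cls Q v)

  IsOmegaTilde : ℕ → Set
  IsOmegaTilde w =
    (∀ K → IsMaximalClique G K → ∣ tildeSet K ∣ ≤ w)
    × ∃ λ K → IsMaximalClique G K × ∣ tildeSet K ∣ ≡ w

module Submission where

open import Defs hiding (sym)
open import Data.Nat using (ℕ; zero; suc; _≤_; _*_; _+_; z≤n; s≤s)
open import Data.Nat.Properties using (≤-trans; ≤-reflexive; +-monoʳ-≤; +-mono-≤; +-suc)
open import Data.Bool using (Bool; true; false)
import Data.Bool.Properties as Bool
open import Data.Fin using (Fin; zero; suc; _≟_)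
open import Data.Fin.Properties using (any?; all?)
open import Data.Fin.Subset
  using (Subset; _∩_; _∪_; ∣_∣; _∈_; _∉_; _⊆_; _⊂_; _⊃_; ⁅_⁆; ⊥)
open import Data.Fin.Subset.Properties
  using (_∈?_; ∣⊥∣≡0; ∣p∣≤∣x∷p∣; p⊆q⇒∣p∣≤∣q∣; ⊆-refl; x∈⁅x⁆; x∈⁅y⁆⇒x≡y;
         x∈p∩q⁺; x∈p∩q⁻; p⊆p∪q; q⊆p∪q; x∈p∪q⁻)
open import Data.Fin.Subset.Induction using (Acc; acc; ⊃-wellFounded)
open import Data.Vec using (_∷_; []; tabulate; lookup; here; there)
open import Data.Vec.Properties using (lookup∘tabulate; []=⇒lookup; lookup⇒[]=)
open import Data.Product using (Σ; ∃; _×_; _,_; proj₁; proj₂)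
open import Data.Sum using (inj₁; inj₂)
open import Data.Empty using (⊥-elim)
open import Function using (_∘_)
open import Function.Bundles using (Equivalence)
open import Relation.Nullary using (¬_; Dec; yes; no; does; ¬?)
open import Relation.Nullary.Decidable using (_×-dec_; _→-dec_; dec-true)
open import Relation.Binary.PropositionalEquality
  using (_≡_; _≢_; refl; sym; trans; subst; cong)

-- Twins lie in the same maximal cliques, so distinct twins are adjacent and
-- adjacency only depends on twin classes.  Hence an edge of G̃ across (Ã, B̃)
-- lifts to an edge of G across (A, B), and a class meeting both A and B has a
-- member in A ∩ B (otherwise two twins, one in A ∖ B and one in B ∖ A, would be
-- adjacent).  A clique of G meets at most ω̃(G) classes, so a cover of A ∩ B by
-- k cliques meets at most k·ω̃(G) classes.  Conversely each class is a clique of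
-- G, so the k classes of Ã ∩ B̃ cover (⋃Ã) ∩ (⋃B̃).

module _ {n : ℕ} where

  ∈-tabulate⁺ : (f : Fin n → Bool) {x : Fin n} → f x ≡ true → x ∈ tabulate f
  ∈-tabulate⁺ f {x} fx = lookup⇒[]= x _ (trans (lookup∘tabulate f x) fx)

  ∈-tabulate⁻ : (f : Fin n → Bool) {x : Fin n} → x ∈ tabulate f → f x ≡ true
  ∈-tabulate⁻ f {x} x∈ = trans (sym (lookup∘tabulate f x)) ([]=⇒lookup x∈)

does⇒witness : ∀ {A : Set} (a? : Dec A) → does a? ≡ true → A
does⇒witness (yes a) _ = a

∣p∪q∣≤∣p∣+∣q∣ : ∀ {n} (p q : Subset n) → ∣ p ∪ q ∣ ≤ ∣ p ∣ + ∣ q ∣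
∣p∪q∣≤∣p∣+∣q∣ []          []          = z≤n
∣p∪q∣≤∣p∣+∣q∣ (true  ∷ p) (y ∷ q)     =
  s≤s (≤-trans (∣p∪q∣≤∣p∣+∣q∣ p q) (+-monoʳ-≤ ∣ p ∣ (∣p∣≤∣x∷p∣ y q)))
∣p∪q∣≤∣p∣+∣q∣ (false ∷ p) (true  ∷ q) rewrite +-suc ∣ p ∣ ∣ q ∣ = s≤s (∣p∪q∣≤∣p∣+∣q∣ p q)
∣p∪q∣≤∣p∣+∣q∣ (false ∷ p) (false ∷ q) = ∣p∪q∣≤∣p∣+∣q∣ p q

⋃ᶠ : ∀ {n} t → (Fin t → Subset n) → Subset n
⋃ᶠ zero    F = ⊥
⋃ᶠ (suc t) F = F zero ∪ ⋃ᶠ t (F ∘ suc)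

x∈F⇒x∈⋃ᶠ : ∀ {n} t (F : Fin t → Subset n) i {x} → x ∈ F i → x ∈ ⋃ᶠ t F
x∈F⇒x∈⋃ᶠ (suc t) F zero    x∈ = p⊆p∪q _ x∈
x∈F⇒x∈⋃ᶠ (suc t) F (suc i) x∈ = q⊆p∪q (F zero) _ (x∈F⇒x∈⋃ᶠ t (F ∘ suc) i x∈)

∣⋃ᶠ∣≤t*w : ∀ {n} t (F : Fin t → Subset n) w → (∀ i → ∣ F i ∣ ≤ w) → ∣ ⋃ᶠ t F ∣ ≤ t * w
∣⋃ᶠ∣≤t*w {n} zero    F w _     = ≤-reflexive (∣⊥∣≡0 n)
∣⋃ᶠ∣≤t*w     (suc t) F w ∣F∣≤w =
  ≤-trans (∣p∪q∣≤∣p∣+∣q∣ (F zero) _) (+-mono-≤ (∣F∣≤w zero) (∣⋃ᶠ∣≤t*w t (F ∘ suc) w (∣F∣≤w ∘ suc)))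

enumerate : ∀ {n} (S : Subset n) → Fin ∣ S ∣ → Fin n
enumerate (true  ∷ S) zero    = zero
enumerate (true  ∷ S) (suc i) = suc (enumerate S i)
enumerate (false ∷ S) i       = suc (enumerate S i)

enumerate-∈ : ∀ {n} (S : Subset n) i → enumerate S i ∈ S
enumerate-∈ (true  ∷ S) zero    = here
enumerate-∈ (true  ∷ S) (suc i) = there (enumerate-∈ S i)
enumerate-∈ (false ∷ S) i       = there (enumerate-∈ S i)

enumerate-surjective : ∀ {n} (S : Subset n) {x} → x ∈ S → ∃ λ i → enumerate S i ≡ x
enumerate-surjective (true  ∷ S) here       = zero , refl
enumerate-surjective (true  ∷ S) (there x∈) =
  let i , eq = enumerate-surjective S x∈ in suc i , cong suc eq
enumerate-surjective (false ∷ S) (there x∈) =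
  let i , eq = enumerate-surjective S x∈ in i , cong suc eq

module _ {n : ℕ} (G : SimpleGraph n) where

  Adjacent : Fin n → Fin n → Set
  Adjacent u v = adj G u v ≡ true

  Enlarges : Subset n → Fin n → Set
  Enlarges K x = x ∉ K × (∀ y → y ∈ K → Adjacent x y)

  enlarges? : ∀ K x → Dec (Enlarges K x)
  enlarges? K x = ¬? (x ∈? K) ×-dec all? (λ y → (y ∈? K) →-dec (adj G x y Bool.≟ true))

  unenlargeable⇒maximal : ∀ K → IsClique G K → ¬ (∃ λ x → Enlarges K x) → IsMaximalClique G K
  unenlargeable⇒maximal K K-clique stuck = K-clique , maximal
    where
    maximal : ∀ K′ → IsClique G K′ → K ⊆ K′ → K′ ⊆ K
    maximal K′ K′-clique K⊆K′ {x} x∈K′ with x ∈? K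
    ... | yes x∈K = x∈K
    ... | no  x∉K = ⊥-elim (stuck (x , x∉K , λ y y∈K →
          K′-clique x y x∈K′ (K⊆K′ y∈K) (λ { refl → x∉K y∈K })))

  ∪⁅⁆-clique : ∀ {K x} → IsClique G K → Enlarges K x → IsClique G (K ∪ ⁅ x ⁆)
  ∪⁅⁆-clique {K} {x} K-clique (_ , x~K) u v u∈ v∈ u≢v
    with x∈p∪q⁻ K ⁅ x ⁆ u∈ | x∈p∪q⁻ K ⁅ x ⁆ v∈
  ... | inj₁ u∈K | inj₁ v∈K = K-clique u v u∈K v∈K u≢v
  ... | inj₂ u∈x | inj₁ v∈K rewrite x∈⁅y⁆⇒x≡y x u∈x = x~K v v∈K
  ... | inj₁ u∈K | inj₂ v∈x rewrite x∈⁅y⁆⇒x≡y x v∈x = trans (SimpleGraph.sym G u x) (x~K u u∈K)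
  ... | inj₂ u∈x | inj₂ v∈x = ⊥-elim (u≢v (trans (x∈⁅y⁆⇒x≡y x u∈x) (sym (x∈⁅y⁆⇒x≡y x v∈x))))

  ⁅⁆-clique : ∀ u → IsClique G ⁅ u ⁆
  ⁅⁆-clique u a b a∈ b∈ a≢b = ⊥-elim (a≢b (trans (x∈⁅y⁆⇒x≡y u a∈) (sym (x∈⁅y⁆⇒x≡y u b∈))))

  edge-clique : ∀ {u v} → Adjacent u v → IsClique G (⁅ u ⁆ ∪ ⁅ v ⁆)
  edge-clique {u} {v} u~v = ∪⁅⁆-clique (⁅⁆-clique u) (v∉⁅u⁆ , v~u)
    where
    v∉⁅u⁆ : v ∉ ⁅ u ⁆
    v∉⁅u⁆ v∈ with x∈⁅y⁆⇒x≡y u v∈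
    ... | refl with trans (sym (irrefl G v)) u~v
    ... | ()
    v~u : ∀ y → y ∈ ⁅ u ⁆ → Adjacent v y
    v~u y y∈ rewrite x∈⁅y⁆⇒x≡y u y∈ = trans (SimpleGraph.sym G v u) u~v

  extendToMaximal : ∀ {K} → Acc _⊃_ K → IsClique G K →
                    Σ (Subset n) λ M → IsMaximalClique G M × K ⊆ M
  extendToMaximal {K} (acc larger) K-clique with any? (enlarges? K)
  ... | no  stuck = K , unenlargeable⇒maximal K K-clique stuck , ⊆-refl
  ... | yes (x , x∉K , x~K) =
    let M , M-maximal , K∪x⊆M = extendToMaximal (larger K⊂K∪x) (∪⁅⁆-clique K-clique (x∉K , x~K))
    in  M , M-maximal , K∪x⊆M ∘ p⊆p∪q _
    where
    K⊂K∪x : K ⊂ K ∪ ⁅ x ⁆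
    K⊂K∪x = p⊆p∪q _ , x , q⊆p∪q K _ (x∈⁅x⁆ x) , x∉K

  clique⊆maximalClique : ∀ {K} → IsClique G K → Σ (Subset n) λ M → IsMaximalClique G M × K ⊆ M
  clique⊆maximalClique {K} = extendToMaximal (⊃-wellFounded K)

  cliqueCover-cong : ∀ {S T t} → S ⊆ T → T ⊆ S → CliqueCover G S t → CliqueCover G T t
  cliqueCover-cong S⊆T T⊆S (K , K-clique , covers) =
    K , (λ i → proj₁ (K-clique i) , S⊆T ∘ proj₂ (K-clique i)) , λ v → covers v ∘ T⊆S

module _ {n : ℕ} {G : SimpleGraph n} (Q : TwinQuotient G) where

  twin-∈ : ∀ {u v K} → cls Q u ≡ cls Q v → IsMaximalClique G K → u ∈ K → v ∈ K
  twin-∈ {u} {v} {K} same max = Equivalence.to (Equivalence.to (cls-twin Q u v) same K max)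

  twins⇒adjacent : ∀ {u v} → u ≢ v → cls Q u ≡ cls Q v → Adjacent G u v
  twins⇒adjacent {u} {v} u≢v same =
    let M , M-maximal , u∈M = clique⊆maximalClique G (⁅⁆-clique G u)
        u∈M = u∈M (x∈⁅x⁆ u)
    in  proj₁ M-maximal u v u∈M (twin-∈ same M-maximal u∈M) u≢v

  adjacent-twins : ∀ {u v x y} → Adjacent G u v → cls Q u ≡ cls Q x → cls Q v ≡ cls Q y →
                   x ≢ y → Adjacent G x y
  adjacent-twins {u} {v} {x} {y} u~v ux vy x≢y =
    let M , M-maximal , uv⊆M = clique⊆maximalClique G (edge-clique G u~v)
    in  proj₁ M-maximal x y (twin-∈ ux M-maximal (uv⊆M (p⊆p∪q _ (x∈⁅x⁆ u))))
                            (twin-∈ vy M-maximal (uv⊆M (q⊆p∪q ⁅ u ⁆ _ (x∈⁅x⁆ v)))) x≢y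

  ∈-tildeSet⁺ : ∀ {X v} → v ∈ X → cls Q v ∈ tildeSet Q X
  ∈-tildeSet⁺ {X} {v} v∈ = ∈-tabulate⁺ _ (dec-true (any? _) (v , v∈ , refl))

  ∈-tildeSet⁻ : ∀ {X c} → c ∈ tildeSet Q X → ∃ λ v → v ∈ X × cls Q v ≡ c
  ∈-tildeSet⁻ {X} {c} c∈ = does⇒witness (any? _) (∈-tabulate⁻ _ c∈)

  tildeSet-mono : ∀ {X Y} → X ⊆ Y → tildeSet Q X ⊆ tildeSet Q Y
  tildeSet-mono X⊆Y c∈ with ∈-tildeSet⁻ c∈
  ... | v , v∈X , refl = ∈-tildeSet⁺ (X⊆Y v∈X)

  ∈-unionSet⁺ : ∀ {Y v} → cls Q v ∈ Y → v ∈ unionSet Q Y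
  ∈-unionSet⁺ c∈ = ∈-tabulate⁺ _ ([]=⇒lookup c∈)

  ∈-unionSet⁻ : ∀ {Y v} → v ∈ unionSet Q Y → cls Q v ∈ Y
  ∈-unionSet⁻ v∈ = lookup⇒[]= _ _ (∈-tabulate⁻ _ v∈)

  tildeSet-separation : ∀ {A B} → IsSeparation (Adjacent G) A B →
                        IsSeparation (QAdj Q) (tildeSet Q A) (tildeSet Q B)
  tildeSet-separation sep c d c∈Ã c∉B̃ d∈B̃ d∉Ã (c≢d , u , v , uc , vd , u~v)
    with ∈-tildeSet⁻ c∈Ã | ∈-tildeSet⁻ d∈B̃
  ... | x , x∈A , refl | y , y∈B , refl =
    sep x y x∈A (c∉B̃ ∘ ∈-tildeSet⁺) y∈B (d∉Ã ∘ ∈-tildeSet⁺)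
        (adjacent-twins u~v uc vd (c≢d ∘ cong (cls Q)))

  separation⇒tildeSet-∩ : ∀ {A B} → IsSeparation (Adjacent G) A B →
                          tildeSet Q A ∩ tildeSet Q B ⊆ tildeSet Q (A ∩ B)
  separation⇒tildeSet-∩ {A} {B} sep c∈ with x∈p∩q⁻ (tildeSet Q A) _ c∈
  ... | c∈Ã , c∈B̃ with ∈-tildeSet⁻ c∈Ã | ∈-tildeSet⁻ c∈B̃
  ... | a , a∈A , refl | b , b∈B , ba with a ∈? B | b ∈? A
  ... | yes a∈B | _       = ∈-tildeSet⁺ (x∈p∩q⁺ (a∈A , a∈B))
  ... | no  _   | yes b∈A = subst (_∈ tildeSet Q (A ∩ B)) ba (∈-tildeSet⁺ (x∈p∩q⁺ (b∈A , b∈B)))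
  ... | no  a∉B | no  b∉A =
    ⊥-elim (sep a b a∈A a∉B b∈B b∉A (twins⇒adjacent (λ { refl → b∉A a∈A }) (sym ba)))

  ∣tildeSet∣≤θ*ω̃ : ∀ {S t w} → (∀ K → IsMaximalClique G K → ∣ tildeSet Q K ∣ ≤ w) →
                   CliqueCover G S t → ∣ tildeSet Q S ∣ ≤ t * w
  ∣tildeSet∣≤θ*ω̃ {S} {t} {w} ω̃≤w (K , K-clique , covers) =
    ≤-trans (p⊆q⇒∣p∣≤∣q∣ S̃⊆⋃K̃) (∣⋃ᶠ∣≤t*w t (tildeSet Q ∘ K) w ∣K̃∣≤w)
    where
    ∣K̃∣≤w : ∀ i → ∣ tildeSet Q (K i) ∣ ≤ w
    ∣K̃∣≤w i =
      let M , M-maximal , K⊆M = clique⊆maximalClique G (proj₁ (K-clique i))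
      in  ≤-trans (p⊆q⇒∣p∣≤∣q∣ (tildeSet-mono K⊆M)) (ω̃≤w M M-maximal)
    S̃⊆⋃K̃ : tildeSet Q S ⊆ ⋃ᶠ t (tildeSet Q ∘ K)
    S̃⊆⋃K̃ c∈ with ∈-tildeSet⁻ c∈
    ... | v , v∈S , refl = let i , v∈K = covers v v∈S in x∈F⇒x∈⋃ᶠ t _ i (∈-tildeSet⁺ v∈K)

  unionSet-separation : ∀ {A′ B′} → IsSeparation (QAdj Q) A′ B′ →
                        IsSeparation (Adjacent G) (unionSet Q A′) (unionSet Q B′)
  unionSet-separation {A′} sep u v u∈⋃A′ u∉⋃B′ v∈⋃B′ v∉⋃A′ u~v with cls Q u ≟ cls Q v
  ... | yes same = v∉⋃A′ (∈-unionSet⁺ (subst (_∈ A′) same (∈-unionSet⁻ u∈⋃A′)))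
  ... | no  diff = sep (cls Q u) (cls Q v) (∈-unionSet⁻ u∈⋃A′) (u∉⋃B′ ∘ ∈-unionSet⁺)
                       (∈-unionSet⁻ v∈⋃B′) (v∉⋃A′ ∘ ∈-unionSet⁺) (diff , u , v , refl , refl , u~v)

  class : Fin (m Q) → Subset n
  class c = tabulate λ v → does (cls Q v ≟ c)

  ∈-class⁺ : ∀ {c v} → cls Q v ≡ c → v ∈ class c
  ∈-class⁺ {c} {v} vc = ∈-tabulate⁺ _ (dec-true (cls Q v ≟ c) vc)

  ∈-class⁻ : ∀ {c v} → v ∈ class c → cls Q v ≡ c
  ∈-class⁻ v∈ = does⇒witness (cls Q _ ≟ _) (∈-tabulate⁻ _ v∈)

  class-clique : ∀ c → IsClique G (class c)
  class-clique c u v u∈ v∈ u≢v = twins⇒adjacent u≢v (trans (∈-class⁻ u∈) (sym (∈-class⁻ v∈)))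

  unionSet-cliqueCover : ∀ P → CliqueCover G (unionSet Q P) ∣ P ∣
  unionSet-cliqueCover P = class ∘ enumerate P , (λ i → class-clique _ , class⊆⋃P i) , covers
    where
    class⊆⋃P : ∀ i → class (enumerate P i) ⊆ unionSet Q P
    class⊆⋃P i v∈ = ∈-unionSet⁺ (subst (_∈ P) (sym (∈-class⁻ v∈)) (enumerate-∈ P i))
    covers : ∀ v → v ∈ unionSet Q P → ∃ λ i → v ∈ class (enumerate P i)
    covers v v∈ = let i , eq = enumerate-surjective P (∈-unionSet⁻ v∈) in i , ∈-class⁺ (sym eq)

  unionSet-∩⁺ : ∀ {A′ B′} → unionSet Q A′ ∩ unionSet Q B′ ⊆ unionSet Q (A′ ∩ B′)
  unionSet-∩⁺ {A′} {B′} v∈ =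
    let v∈⋃A′ , v∈⋃B′ = x∈p∩q⁻ (unionSet Q A′) _ v∈
    in  ∈-unionSet⁺ {A′ ∩ B′} (x∈p∩q⁺ (∈-unionSet⁻ v∈⋃A′ , ∈-unionSet⁻ v∈⋃B′))

  unionSet-∩⁻ : ∀ {A′ B′} → unionSet Q (A′ ∩ B′) ⊆ unionSet Q A′ ∩ unionSet Q B′
  unionSet-∩⁻ {A′} v∈ =
    let c∈A′ , c∈B′ = x∈p∩q⁻ A′ _ (∈-unionSet⁻ v∈)
    in  x∈p∩q⁺ (∈-unionSet⁺ c∈A′ , ∈-unionSet⁺ c∈B′)

lemma4p1 : ∀ {n} (G : SimpleGraph n) (Q : TwinQuotient G) (k : ℕ) → 1 ≤ k →
    (∀ (A B : Subset n) →
      IsSeparation (λ u v → adj G u v ≡ true) A B →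
      CliqueCoverNumber G (A ∩ B) k →
      IsSeparation (QAdj Q) (tildeSet Q A) (tildeSet Q B)
      × (∀ w → IsOmegaTilde Q w → ∣ tildeSet Q A ∩ tildeSet Q B ∣ ≤ k * w))
    ×
    (∀ (A′ B′ : Subset (m Q)) →
      IsSeparation (QAdj Q) A′ B′ →
      ∣ A′ ∩ B′ ∣ ≡ k →
      IsSeparation (λ u v → adj G u v ≡ true) (unionSet Q A′) (unionSet Q B′)
      × CliqueCoverNumber≤ G (unionSet Q A′ ∩ unionSet Q B′) k)
lemma4p1 G Q k _ = part₁ , part₂
  where
  part₁ = λ A B sep (cover , _) →
    tildeSet-separation Q sep ,
    λ w (ω̃≤w , _) → ≤-trans (p⊆q⇒∣p∣≤∣q∣ (separation⇒tildeSet-∩ Q sep)) (∣tildeSet∣≤θ*ω̃ Q ω̃≤w cover)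
  part₂ = λ A′ B′ sep ∣A′∩B′∣≡k →
    unionSet-separation Q sep ,
    ∣ A′ ∩ B′ ∣ , ≤-reflexive ∣A′∩B′∣≡k ,
    cliqueCover-cong G (unionSet-∩⁻ Q {A′}) (unionSet-∩⁺ Q {A′}) (unionSet-cliqueCover Q (A′ ∩ B′))
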